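{- Let $a<b$ be positive integers and $\lambda$ a partition. Suppose $r_\alpha$ and $r_\beta$ are each the smallest rectangle containing some run of $b$ consecutive boxes of the rim of $\lambda$ (so $r_\alpha^x+r_\alpha^y=r_\beta^x+r_\beta^y=b+1$), with $r_\alpha^x>a\ge r_\beta^x$. Suppose also that the northeast-most box $B_0=(i_0,j_0)$ of $r_\alpha$ satisfies $(i_0,j_0+1)\notin\lambda$. If $r_\beta$ contains a box strictly southwest of $r_\alpha$, then $\lambda$ contains a box $(i,j)$ whose hook has leg length $l_{i,j}=a$ and arm length $a_{i,j}=b-a-1$.
   Context: Partitions are identified with Young diagrams $\{(i,j)\in\mathbb{Z}_{>0}^2: j\le\lambda_i\}$ (row $i$ increases southwards, column $j$ increases eastwards). The rim of $\lambda$ is $\{(i,j)\in\lambda:(i+1,j+1)\notin\lambda\}$; it is a connected path of edge-adjacent boxes ordered from $(1,\lambda_1)$ southwestwards to $(l(\lambda),1)$, and "consecutive" refers to this order. A rectangle means a set of boxes $[i_1,i_2]\times[j_1,j_2]$; for a rectangle $r$, $r^x$ is its number of rows and $r^y$ its number of columns. A box is strictly southwest of $r_\alpha$ if its row index exceeds every row index of $r_\alpha$ and its column index is less than every column index of $r_\alpha$. Arm $a_{i,j}=\lambda_i-j$, leg $l_{i,j}=\lambda^{\mathrm{Tr}}_j-i$. -}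

module Defs where

open import Data.Nat using (ℕ; zero; suc; _+_; _∸_; _≤_; _<_; _≤?_; _⊔_; _⊓_)
open import Data.List using (List; []; _∷_; length; filter; map)
open import Data.List.Relation.Unary.All using (All)
open import Data.List.Relation.Unary.Linked using (Linked)
open import Data.Product using (_×_; _,_; proj₁; proj₂)
open import Relation.Nullary using (yes; no)
open import Function using (_∘_)

record Partition : Set where
  constructor mkPartition
  field
    parts      : List ℕ
    decreasing : Linked (λ x y → y ≤ x) parts
    positive   : All (0 <_) parts
open Partition public

nth : List ℕ → ℕ → ℕ
nth []       _       = 0
nth (x ∷ xs) zero    = x
nth (x ∷ xs) (suc i) = nth xs i

-- row length λ_i, rows 1-indexed (λ_0 := 0, and λ_i = 0 for i > l(λ))
rowLen : Partition → ℕ → ℕ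
rowLen p zero    = 0
rowLen p (suc i) = nth (parts p) i

numRows : Partition → ℕ
numRows p = length (parts p)

colLen : Partition → ℕ → ℕ
colLen p j = length (filter (j ≤?_) (parts p))

Box : Set
Box = ℕ × ℕ   -- (row i, column j)

_∈λ_ : Box → Partition → Set
(i , j) ∈λ p = 1 ≤ i × 1 ≤ j × j ≤ rowLen p i

arm : Partition → Box → ℕ
arm p (i , j) = rowLen p i ∸ j

leg : Partition → Box → ℕ
leg p (i , j) = colLen p j ∸ i

-- Rim ordered from (1,λ₁) southwestwards to (l(λ),1):
-- from a rim box (i,j), the next rim box is (i+1,j) if it lies in λ, else (i,j-1).
rimStep : Partition → Box → Box
rimStep p (i , j) with j ≤? rowLen p (suc i)
... | yes _ = (suc i , j)
... | no  _ = (i , j ∸ 1)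

rimBox : Partition → ℕ → Box
rimBox p zero    = (1 , rowLen p 1)
rimBox p (suc k) = rimStep p (rimBox p k)

rimLength : Partition → ℕ
rimLength p = rowLen p 1 + numRows p ∸ 1

run : Partition → ℕ → ℕ → List Box
run p s zero    = []
run p s (suc b) = rimBox p s ∷ run p (suc s) b

record Rect : Set where
  constructor rect
  field
    i₁ i₂ j₁ j₂ : ℕ
open Rect public

rowsOf : Rect → ℕ
rowsOf r = suc (i₂ r) ∸ i₁ r

colsOf : Rect → ℕ
colsOf r = suc (j₂ r) ∸ j₁ r

boundingRect : Box → List Box → Rect
boundingRect (i , j) [] = rect i i j j
boundingRect (i , j) (x ∷ xs) =
  let r = boundingRect x xs in rect (i ⊓ i₁ r) (i ⊔ i₂ r) (j ⊓ j₁ r) (j ⊔ j₂ r)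

runRect : Partition → ℕ → ℕ → Rect
runRect p s zero    = rect 0 0 0 0   -- unused (runs are nonempty)
runRect p s (suc b) = boundingRect (rimBox p s) (run p (suc s) b)

_∈R_ : Box → Rect → Set
(i , j) ∈R r = i₁ r ≤ i × i ≤ i₂ r × j₁ r ≤ j × j ≤ j₂ r

StrictlySW : Box → Rect → Set
StrictlySW (i , j) r = i₂ r < i × j < j₁ r

neBox : Rect → Box
neBox r = (i₁ r , j₂ r)

module Submission where

-- The box (i , λᵢ − c) has leg a and arm c exactly when λᵢ − λᵢ₊ₐ ≤ c < λᵢ − λᵢ₊ₐ₊₁.
-- A run of b = a + c + 1 rim boxes goes d rows south and e columns west with d + e = a + c.
-- For the tall run (d ≥ a, so e ≤ c), whose first box has no eastern neighbour, the left
-- inequality holds at its first row; for the short run (d < a, so e > c) the right one holds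
-- at its first row, which the southwest box places further south.  Going down from the
-- former row, the left inequality persists until the first row where the right one holds.

open import Defs
open import Data.Nat using (ℕ; zero; suc; _+_; _∸_; _≤_; _<_; _≥_; _≤?_; z≤n; s≤s; s≤s⁻¹)
open import Data.Nat.Properties
open import Data.List using (List; []; _∷_; length; filter)
open import Data.List.Properties using (filter-accept; filter-reject)
open import Data.List.Relation.Unary.Linked using (Linked; []; [-]; _∷_)
open import Data.Product using (Σ; ∃-syntax; _×_; _,_; proj₁; proj₂)
open import Relation.Nullary using (¬_; yes; no; contradiction)
open import Relation.Unary using (Decidable)
open import Relation.Binary.PropositionalEquality
  using (_≡_; refl; sym; trans; cong; subst; subst₂)

crossing : ∀ {P Q : ℕ → Set} → Decidable Q → (∀ {i} → P i → ¬ Q i → P (suc i)) →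
           ∀ n {i} → P i → Q (n + i) → ∃[ k ] P k × Q k
crossing Q? next zero    {i} Pi Qi = i , Pi , Qi
crossing {Q = Q} Q? next (suc n) {i} Pi Qn+i with Q? i
... | yes Qi = i , Pi , Qi
... | no ¬Qi = crossing Q? next n (next Pi ¬Qi) (subst Q (sym (+-suc n i)) Qn+i)

Antitone : List ℕ → Set
Antitone = Linked _≥_

Antitone-tail : ∀ {x xs} → Antitone (x ∷ xs) → Antitone xs
Antitone-tail [-]     = []
Antitone-tail (_ ∷ d) = d

nth≤head : ∀ {x xs} → Antitone (x ∷ xs) → ∀ n → nth (x ∷ xs) n ≤ x
nth≤head d zero = ≤-refl
nth≤head {xs = []}    d       (suc n) = z≤n
nth≤head {xs = _ ∷ _} (y≤x ∷ d) (suc n) = ≤-trans (nth≤head d n) y≤x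

nth-antitone : ∀ {xs} → Antitone xs → ∀ {m n} → m ≤ n → nth xs n ≤ nth xs m
nth-antitone {[]}    d _ = z≤n
nth-antitone {_ ∷ _} d {zero}  {n} _ = nth≤head d n
nth-antitone {_ ∷ _} d {suc m} {suc n} m≤n = nth-antitone (Antitone-tail d) (s≤s⁻¹ m≤n)

count-≥-zero : ∀ {xs} j → Antitone xs → nth xs 0 < j → length (filter (j ≤?_) xs) ≡ 0
count-≥-zero {[]}    j d _ = refl
count-≥-zero {x ∷ _} j d x<j = trans
  (cong length (filter-reject (j ≤?_) (<⇒≱ x<j)))
  (count-≥-zero j (Antitone-tail d) (≤-<-trans (nth≤head d 1) x<j))

count-≥-suc : ∀ {xs} j k → Antitone xs → j ≤ nth xs k → nth xs (suc k) < j →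
              length (filter (j ≤?_) xs) ≡ suc k
count-≥-suc {[]} j k d j≤ <j = contradiction j≤ (<⇒≱ <j)
count-≥-suc {x ∷ _} j zero d j≤x <j = trans
  (cong length (filter-accept (j ≤?_) j≤x))
  (cong suc (count-≥-zero j (Antitone-tail d) <j))
count-≥-suc {x ∷ _} j (suc k) d j≤ <j = trans
  (cong length (filter-accept (j ≤?_) (≤-trans j≤ (nth≤head d (suc k)))))
  (cong suc (count-≥-suc j k (Antitone-tail d) j≤ <j))

rowLen-antitone : ∀ p {m n} → 1 ≤ m → m ≤ n → rowLen p n ≤ rowLen p m
rowLen-antitone p {suc m} {suc n} _ m≤n = nth-antitone (decreasing p) (s≤s⁻¹ m≤n)

colLen-≡ : ∀ p j k → j ≤ rowLen p (suc k) → rowLen p (suc (suc k)) < j → colLen p j ≡ suc k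
colLen-≡ p j k = count-≥-suc j k (decreasing p)

east-free : ∀ p {i j} → 1 ≤ i → ¬ ((i , suc j) ∈λ p) → rowLen p i ≤ j
east-free p 1≤i ∉λ = s≤s⁻¹ (≰⇒> (λ j<row → ∉λ (1≤i , s≤s z≤n , j<row)))

HasHook : Partition → ℕ → ℕ → Set
HasHook p a c = Σ Box (λ B → B ∈λ p × leg p B ≡ a × arm p B ≡ c)

SmallDrop LargeDrop : Partition → ℕ → ℕ → ℕ → Set
SmallDrop p a c i = rowLen p i ≤ c + rowLen p (i + a)
LargeDrop p a c i = c + rowLen p (suc (i + a)) < rowLen p i

hook-at-drop : ∀ p a c i → SmallDrop p a c i → LargeDrop p a c i → HasHook p a c
hook-at-drop p a c zero    _     ()
hook-at-drop p a c (suc k) small large =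
  (suc k , row ∸ c) , (s≤s z≤n , m<n⇒0<n∸m c<row , m∸n≤m row c) , leg≡ , m∸[m∸n]≡n (<⇒≤ c<row)
  where
    row : ℕ
    row = rowLen p (suc k)
    c<row : c < row
    c<row = ≤-<-trans (m≤m+n c _) large
    below<j : rowLen p (suc (suc (k + a))) < row ∸ c
    below<j = m+n≤o⇒m≤o∸n _ (≤-trans (≤-reflexive (cong suc (+-comm _ c))) large)
    leg≡ : colLen p (row ∸ c) ∸ suc k ≡ a
    leg≡ = trans (cong (_∸ suc k) (colLen-≡ p (row ∸ c) (k + a) (m≤n+o⇒m∸n≤o row c small) below<j))
                 (m+n∸m≡n (suc k) a)

hook-between : ∀ p a c {i k} → 1 ≤ i → i ≤ k → SmallDrop p a c i → LargeDrop p a c k → HasHook p a c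
hook-between p a c {i} {k} 1≤i i≤k small large =
  hook-of (crossing {P = λ m → 1 ≤ m × SmallDrop p a c m}
                    (λ m → suc (c + rowLen p (suc (m + a))) ≤? rowLen p m) next (k ∸ i)
                    (1≤i , small) (subst (LargeDrop p a c) (sym (m∸n+n≡m i≤k)) large))
  where
    next : ∀ {m} → 1 ≤ m × SmallDrop p a c m → ¬ LargeDrop p a c m → 1 ≤ suc m × SmallDrop p a c (suc m)
    next {m} (1≤m , _) ¬large = s≤s z≤n , ≤-trans (rowLen-antitone p 1≤m (n≤1+n m)) (≮⇒≥ ¬large)
    hook-of : ∃[ m ] (1 ≤ m × SmallDrop p a c m) × LargeDrop p a c m → HasHook p a c
    hook-of (m , (_ , small′) , large′) = hook-at-drop p a c m small′ large′

data Step : Box → Box → Set where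
  south : ∀ {i j} → Step (i , j) (suc i , j)
  west  : ∀ {i j} → Step (i , suc j) (i , j)

rimStep-step : ∀ p x → Step x (rimStep p x)
rimStep-step p (i , j) with j ≤? rowLen p (suc i)
... | yes _ = south
rimStep-step p (i , zero)  | no 0≰ = contradiction z≤n 0≰
rimStep-step p (i , suc j) | no _  = west

OnRim : Partition → Box → Set
OnRim p (i , j) = 1 ≤ i × j ≤ rowLen p i × rowLen p (suc i) ≤ j

rimStep-onRim : ∀ p x → OnRim p x → OnRim p (rimStep p x)
rimStep-onRim p (i , j) (_ , _ , below≤j) with j ≤? rowLen p (suc i)
... | yes j≤below = s≤s z≤n , j≤below , ≤-trans (rowLen-antitone p (s≤s z≤n) (n≤1+n (suc i))) below≤j
rimStep-onRim p (i , zero)  _ | no 0≰ = contradiction z≤n 0≰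
rimStep-onRim p (i , suc j) (1≤i , j<row , _) | no j≰ = 1≤i , <⇒≤ j<row , s≤s⁻¹ (≰⇒> j≰)

rimBox-onRim : ∀ p k → OnRim p (rimBox p k)
rimBox-onRim p zero    = ≤-refl , ≤-refl , rowLen-antitone p ≤-refl (n≤1+n 1)
rimBox-onRim p (suc k) = rimStep-onRim p (rimBox p k) (rimBox-onRim p k)

rimRow rimCol : Partition → ℕ → ℕ
rimRow p k = proj₁ (rimBox p k)
rimCol p k = proj₂ (rimBox p k)

record Displacement (n : ℕ) (x y : Box) : Set where
  field
    southward westward : ℕ
    southward+westward : southward + westward ≡ n
    row≡ : proj₁ y ≡ southward + proj₁ x
    col≡ : proj₂ x ≡ westward + proj₂ y
open Displacement

Displacement-step : ∀ {n x y z} → Displacement n x y → Step y z → Displacement (suc n) x z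
Displacement-step D south = record
  { southward = suc (southward D) ; westward = westward D
  ; southward+westward = cong suc (southward+westward D)
  ; row≡ = cong suc (row≡ D) ; col≡ = col≡ D }
Displacement-step {y = _ , suc j} D west = record
  { southward = southward D ; westward = suc (westward D)
  ; southward+westward = trans (+-suc (southward D) (westward D)) (cong suc (southward+westward D))
  ; row≡ = row≡ D ; col≡ = trans (col≡ D) (+-suc (westward D) j) }

rim-displacement : ∀ p s n → Displacement n (rimBox p s) (rimBox p (n + s))
rim-displacement p s zero    = record { southward = 0 ; westward = 0
                                      ; southward+westward = refl ; row≡ = refl ; col≡ = refl }
rim-displacement p s (suc n) =
  Displacement-step (rim-displacement p s n) (rimStep-step p (rimBox p (n + s)))

rimRow-mono : ∀ p n s → rimRow p s ≤ rimRow p (n + s)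
rimRow-mono p n s = ≤-trans (m≤n+m _ (southward D)) (≤-reflexive (sym (row≡ D)))
  where
    D : Displacement n (rimBox p s) (rimBox p (n + s))
    D = rim-displacement p s n

rimCol-antitone : ∀ p n s → rimCol p (n + s) ≤ rimCol p s
rimCol-antitone p n s = ≤-trans (m≤n+m _ (westward D)) (≤-reflexive (sym (col≡ D)))
  where
    D : Displacement n (rimBox p s) (rimBox p (n + s))
    D = rim-displacement p s n

runRect-≡ : ∀ p s n → runRect p s (suc n) ≡ rect (rimRow p s) (rimRow p (n + s)) (rimCol p (n + s)) (rimCol p s)
runRect-≡ p s zero = refl
runRect-≡ p s (suc n)
  rewrite runRect-≡ p (suc s) n | +-suc n s
        | m≤n⇒m⊓n≡m (rimRow-mono p 1 s) | m≤n⇒m⊔n≡n (rimRow-mono p (suc n) s)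
        | m≥n⇒m⊓n≡n (rimCol-antitone p (suc n) s) | m≥n⇒m⊔n≡m (rimCol-antitone p 1 s) = refl

runRect-rows : ∀ p s n → rowsOf (runRect p s (suc n)) ≡ suc (southward (rim-displacement p s n))
runRect-rows p s n rewrite runRect-≡ p s n | row≡ (rim-displacement p s n) =
  m+n∸n≡m (suc (southward (rim-displacement p s n))) (rimRow p s)

neBox-runRect : ∀ p s n → neBox (runRect p s (suc n)) ≡ rimBox p s
neBox-runRect p s n = cong neBox (runRect-≡ p s n)

i₂-runRect : ∀ p s n → i₂ (runRect p s (suc n)) ≡ rimRow p (n + s)
i₂-runRect p s n = cong i₂ (runRect-≡ p s n)

module _ (p : Partition) (a c : ℕ) where

  tall-run : ∀ s → a < rowsOf (runRect p s (suc (a + c))) →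
             a + rimRow p s ≤ rimRow p (a + c + s) × rimCol p s ≤ c + rimCol p (a + c + s)
  tall-run s a<rows = rows , cols
    where
      D : Displacement (a + c) (rimBox p s) (rimBox p (a + c + s))
      D = rim-displacement p s (a + c)
      a≤d : a ≤ southward D
      a≤d = s≤s⁻¹ (subst (a <_) (runRect-rows p s (a + c)) a<rows)
      e≤c : westward D ≤ c
      e≤c = +-cancelˡ-≤ a _ _ (≤-trans (+-monoˡ-≤ (westward D) a≤d) (≤-reflexive (southward+westward D)))
      rows : a + rimRow p s ≤ rimRow p (a + c + s)
      rows = ≤-trans (+-monoˡ-≤ _ a≤d) (≤-reflexive (sym (row≡ D)))
      cols : rimCol p s ≤ c + rimCol p (a + c + s)
      cols = ≤-trans (≤-reflexive (col≡ D)) (+-monoˡ-≤ _ e≤c)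

  short-run : ∀ t → rowsOf (runRect p t (suc (a + c))) ≤ a →
              suc (rimRow p (a + c + t)) ≤ a + rimRow p t × suc (c + rimCol p (a + c + t)) ≤ rimCol p t
  short-run t rows≤a = rows , cols
    where
      D : Displacement (a + c) (rimBox p t) (rimBox p (a + c + t))
      D = rim-displacement p t (a + c)
      d<a : southward D < a
      d<a = subst (_≤ a) (runRect-rows p t (a + c)) rows≤a
      c<e : c < westward D
      c<e = +-cancelˡ-< a _ _ (≤-trans (≤-reflexive (cong suc (sym (southward+westward D)))) (+-monoˡ-< (westward D) d<a))
      rows : suc (rimRow p (a + c + t)) ≤ a + rimRow p t
      rows = ≤-trans (≤-reflexive (cong suc (row≡ D))) (+-monoˡ-≤ _ d<a)
      cols : suc (c + rimCol p (a + c + t)) ≤ rimCol p t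
      cols = ≤-trans (+-monoˡ-≤ _ c<e) (≤-reflexive (sym (col≡ D)))

  tall-run-smallDrop : ∀ s → a < rowsOf (runRect p s (suc (a + c))) →
                       rowLen p (rimRow p s) ≤ rimCol p s → SmallDrop p a c (rimRow p s)
  tall-run-smallDrop s tall row≤col = begin
    rowLen p i                   ≤⟨ row≤col ⟩
    rimCol p s                   ≤⟨ proj₂ (tall-run s tall) ⟩
    c + rimCol p (a + c + s)     ≤⟨ +-monoʳ-≤ c (proj₁ (proj₂ (rimBox-onRim p (a + c + s)))) ⟩
    c + rowLen p (rimRow p (a + c + s)) ≤⟨ +-monoʳ-≤ c (rowLen-antitone p (≤-trans 1≤i (m≤m+n i a)) i+a≤) ⟩
    c + rowLen p (i + a)         ∎
    where
      open ≤-Reasoning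
      i : ℕ
      i = rimRow p s
      1≤i : 1 ≤ i
      1≤i = proj₁ (rimBox-onRim p s)
      i+a≤ : i + a ≤ rimRow p (a + c + s)
      i+a≤ = ≤-trans (≤-reflexive (+-comm i a)) (proj₁ (tall-run s tall))

  short-run-largeDrop : ∀ t → rowsOf (runRect p t (suc (a + c))) ≤ a → LargeDrop p a c (rimRow p t)
  short-run-largeDrop t short = begin-strict
    c + rowLen p (suc (i + a))               ≤⟨ +-monoʳ-≤ c (rowLen-antitone p (s≤s z≤n) below≤) ⟩
    c + rowLen p (suc (rimRow p (a + c + t))) ≤⟨ +-monoʳ-≤ c (proj₂ (proj₂ (rimBox-onRim p (a + c + t)))) ⟩
    c + rimCol p (a + c + t)                 <⟨ proj₂ (short-run t short) ⟩
    rimCol p t                               ≤⟨ proj₁ (proj₂ (rimBox-onRim p t)) ⟩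
    rowLen p i                               ∎
    where
      open ≤-Reasoning
      i : ℕ
      i = rimRow p t
      below≤ : suc (rimRow p (a + c + t)) ≤ suc (i + a)
      below≤ = ≤-trans (proj₁ (short-run t short)) (≤-trans (≤-reflexive (+-comm a i)) (n≤1+n (i + a)))

  rimRow-order : ∀ s t → a < rowsOf (runRect p s (suc (a + c))) → rowsOf (runRect p t (suc (a + c))) ≤ a →
                 rimRow p (a + c + s) < rimRow p (a + c + t) → rimRow p s < rimRow p t
  rimRow-order s t tall short ends< = +-cancelˡ-< a _ _ (begin-strict
    a + rimRow p s       ≤⟨ proj₁ (tall-run s tall) ⟩
    rimRow p (a + c + s) <⟨ ends< ⟩
    rimRow p (a + c + t) <⟨ proj₁ (short-run t short) ⟩
    a + rimRow p t       ∎)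
    where open ≤-Reasoning

suc[m+n]∸m∸1≡n : ∀ m n → suc (m + n) ∸ m ∸ 1 ≡ n
suc[m+n]∸m∸1≡n zero    n = refl
suc[m+n]∸m∸1≡n (suc m) n = suc[m+n]∸m∸1≡n m n

lemma3p1 : (a b : ℕ) → 0 < a → a < b → (p : Partition) → (s t : ℕ)
    → s + b ≤ rimLength p → t + b ≤ rimLength p
    → a < rowsOf (runRect p s b) → rowsOf (runRect p t b) ≤ a
    → ¬ ((proj₁ (neBox (runRect p s b)) , suc (proj₂ (neBox (runRect p s b)))) ∈λ p)
    → Σ Box (λ B → B ∈R runRect p t b × StrictlySW B (runRect p s b))
    → Σ Box (λ B → B ∈λ p × leg p B ≡ a × arm p B ≡ (b ∸ a ∸ 1))
lemma3p1 a b _ a<b p s t _ _ tall short east∉λ ((iB , _) , B∈Rt , B-sw) with m≤n⇒∃[o]m+o≡n a<b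
... | c , refl = subst (HasHook p a) (sym (suc[m+n]∸m∸1≡n a c))
  (hook-between p a c 1≤rowₛ (<⇒≤ rowₛ<rowₜ)
    (tall-run-smallDrop p a c s tall (east-free p 1≤rowₛ east∉λ′))
    (short-run-largeDrop p a c t short))
  where
    1≤rowₛ : 1 ≤ rimRow p s
    1≤rowₛ = proj₁ (rimBox-onRim p s)
    east∉λ′ : ¬ ((rimRow p s , suc (rimCol p s)) ∈λ p)
    east∉λ′ = subst (λ B → ¬ ((proj₁ B , suc (proj₂ B)) ∈λ p)) (neBox-runRect p s (a + c)) east∉λ
    rowₛ<rowₜ : rimRow p s < rimRow p t
    rowₛ<rowₜ = rimRow-order p a c s t tall short
      (subst₂ _<_ (i₂-runRect p s (a + c)) (i₂-runRect p t (a + c))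
        (<-≤-trans (proj₁ B-sw) (proj₁ (proj₂ B∈Rt))))
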